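{- The following rules are admissible in $\mathsf{LNS}_\mathsf{Kt}$ (premiss before "/", conclusion after): weakening $\mathsf{W}$: $\mathcal{G}\ast\Gamma\Rightarrow\Delta\ast\mathcal{H}$ / $\mathcal{G}\ast\Gamma,\Sigma\Rightarrow\Delta,\Pi\ast\mathcal{H}$; left contraction $\mathsf{C}_L$: $\mathcal{G}\ast\Gamma,A,A\Rightarrow\Delta\ast\mathcal{H}$ / $\mathcal{G}\ast\Gamma,A\Rightarrow\Delta\ast\mathcal{H}$; right contraction $\mathsf{C}_R$: $\mathcal{G}\ast\Gamma\Rightarrow\Delta,A,A\ast\mathcal{H}$ / $\mathcal{G}\ast\Gamma\Rightarrow\Delta,A\ast\mathcal{H}$.
   Context: Formulae of tense logic $\mathsf{Kt}$ are built from atoms $p$ by $A := p \mid \bot \mid A \to A \mid \Box A \mid \Diamond A \mid \blacksquare A \mid \Diamond^{ -1} A$, where $\Diamond^{ -1}$ denotes the backwards (past) diamond, dual of $\blacksquare$. A linear nested sequent is given by $S := \Gamma\Rightarrow\Delta \mid \Gamma\Rightarrow\Delta \nearrow S \mid \Gamma\Rightarrow\Delta \swarrow S$ with $\Gamma,\Delta$ finite multisets of formulae ($\epsilon$ for empty); $\mathcal{G},\mathcal{H}$ denote possibly empty contexts and each $\ast$ stands for either $\nearrow$ or $\swarrow$. The calculus $\mathsf{LNS}_\mathsf{Kt}$ has the following rules (premisses before "/", conclusion after): $\Box_R^1$: $\mathcal{G}\ast\Gamma\Rightarrow\Delta,A\swarrow\Sigma\Rightarrow\Pi,\Box A$ and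 $\mathcal{G}\ast\Gamma\Rightarrow\Delta\swarrow\Sigma\Rightarrow\Pi,\Box A\nearrow\epsilon\Rightarrow A$ / $\mathcal{G}\ast\Gamma\Rightarrow\Delta\swarrow\Sigma\Rightarrow\Pi,\Box A$; $\blacksquare_R^1$: $\mathcal{G}\ast\Gamma\Rightarrow\Delta,A\nearrow\Sigma\Rightarrow\Pi,\blacksquare A$ and $\mathcal{G}\ast\Gamma\Rightarrow\Delta\nearrow\Sigma\Rightarrow\Pi,\blacksquare A\swarrow\epsilon\Rightarrow A$ / $\mathcal{G}\ast\Gamma\Rightarrow\Delta\nearrow\Sigma\Rightarrow\Pi,\blacksquare A$; $\Box_R^2$: $\mathcal{G}\nearrow\Gamma\Rightarrow\Delta,\Box A\nearrow\epsilon\Rightarrow A$ / $\mathcal{G}\nearrow\Gamma\Rightarrow\Delta,\Box A$; $\blacksquare_R^2$: $\mathcal{G}\swarrow\Gamma\Rightarrow\Delta,\blacksquare A\swarrow\epsilon\Rightarrow A$ / $\mathcal{G}\swarrow\Gamma\Rightarrow\Delta,\blacksquare A$; $\Box_L^1$: $\mathcal{G}\ast\Gamma,\Box A\Rightarrow\Delta\nearrow\Sigma,A\Rightarrow\Pi$ / $\mathcal{G}\ast\Gamma,\Box A\Rightarrow\Delta\nearrow\Sigma\Rightarrow\Pi$; $\blacksquare_L^1$: $\mathcal{G}\ast\Gamma,\blacksquare A\Rightarrow\Delta\swarrow\Sigma,A\Rightarrow\Pi$ / $\mathcal{G}\ast\Gamma,\blacksquare A\Rightarrow\Delta\swarrow\Sigma\Rightarrow\Pi$;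 $\Box_L^2$: $\mathcal{G}\ast\Gamma,A\Rightarrow\Delta$ / $\mathcal{G}\ast\Gamma\Rightarrow\Delta\swarrow\Sigma,\Box A\Rightarrow\Pi$; $\blacksquare_L^2$: $\mathcal{G}\ast\Gamma,A\Rightarrow\Delta$ / $\mathcal{G}\ast\Gamma\Rightarrow\Delta\nearrow\Sigma,\blacksquare A\Rightarrow\Pi$; (id): $\mathcal{G}\ast\Gamma,p\Rightarrow p,\Delta$; $\bot_L$: $\mathcal{G}\ast\Gamma,\bot\Rightarrow\Delta$; $\mathsf{EW}$: $\mathcal{G}$ / $\mathcal{G}\ast\Gamma\Rightarrow\Delta$; $\to_R$: $\mathcal{G}\ast\Gamma,A\Rightarrow\Delta,A\to B,B$ / $\mathcal{G}\ast\Gamma\Rightarrow\Delta,A\to B$; $\to_L$: $\mathcal{G}\ast\Gamma,A\to B,B\Rightarrow\Delta$ and $\mathcal{G}\ast\Gamma,A\to B\Rightarrow\Delta,A$ / $\mathcal{G}\ast\Gamma,A\to B\Rightarrow\Delta$. -}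

module Defs where

open import Data.Nat using (ℕ)
open import Data.List using (List; []; _∷_; _++_; [_])
open import Data.Product using (_×_; _,_; ∃-syntax)
open import Data.Sum using (_⊎_)
open import Relation.Binary.PropositionalEquality using (_≡_)
open import Data.List.Relation.Binary.Permutation.Propositional using (_↭_)
open import Data.List.Relation.Binary.Pointwise using (Pointwise)

infixr 6 _⊃_
data Fml : Set where
  atom : ℕ → Fml
  ⊥'   : Fml
  _⊃_  : Fml → Fml → Fml
  □    : Fml → Fml          -- future box
  ◇    : Fml → Fml
  ■    : Fml → Fml          -- past box
  ◇⁻¹  : Fml → Fml

data Dir : Set where
  ↗ ↙ : Dir

-- a component Γ ⇒ Δ (multisets represented by lists, see Perm rule below)
infix 4.5 _⇒_
record Comp : Set where
  constructor _⇒_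
  field
    ante : List Fml
    succ : List Fml

ε : List Fml
ε = []

-- A linear nested sequent c₁ ∗₁ c₂ ∗₂ ... ∗ₖ₋₁ cₖ is represented by the
-- (possibly empty) prefix [(c₁,∗₁),...,(cₖ₋₁,∗ₖ₋₁)] and its last component cₖ.
-- A context "G ∗" (G possibly empty) is exactly such a prefix.
Prefix : Set
Prefix = List (Comp × Dir)

record LNS : Set where
  constructor ⟨_∣_⟩
  field
    pre  : Prefix
    last : Comp

-- a suffix "∗ H" (H possibly empty): [(∗₁,h₁),...,(∗ₘ,hₘ)]
Suffix : Set
Suffix = List (Dir × Comp)

-- plug G c H  =  G ∗ c ∗ H
plug : Prefix → Comp → Suffix → LNS
plug G c []            = ⟨ G ∣ c ⟩
plug G c ((d , c') ∷ H) = plug (G ++ [ (c , d) ]) c' H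

_≈C_ : Comp → Comp → Set
(Γ ⇒ Δ) ≈C (Γ' ⇒ Δ') = (Γ ↭ Γ') × (Δ ↭ Δ')

_≈E_ : Comp × Dir → Comp × Dir → Set
(c , d) ≈E (c' , d') = (c ≈C c') × (d ≡ d')

_≈S_ : LNS → LNS → Set
⟨ G ∣ c ⟩ ≈S ⟨ G' ∣ c' ⟩ = Pointwise _≈E_ G G' × (c ≈C c')

-- "G ↗" in □R²: the prefix is empty or its last arrow is ↗ (dually for ■R²)
EndsWith : Dir → Prefix → Set
EndsWith d G = (G ≡ []) ⊎ (∃[ G' ] ∃[ c ] (G ≡ G' ++ [ (c , d) ]))

infix 2 ⊢_
data ⊢_ : LNS → Set where
  perm : ∀ {S S'} → ⊢ S → S ≈S S' → ⊢ S'
  □R1 : ∀ {G Γ Δ Σ Π A} →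
        ⊢ ⟨ G ++ [ (Γ ⇒ A ∷ Δ , ↙) ] ∣ Σ ⇒ □ A ∷ Π ⟩ →
        ⊢ ⟨ G ++ (Γ ⇒ Δ , ↙) ∷ (Σ ⇒ □ A ∷ Π , ↗) ∷ [] ∣ ε ⇒ [ A ] ⟩ →
        ⊢ ⟨ G ++ [ (Γ ⇒ Δ , ↙) ] ∣ Σ ⇒ □ A ∷ Π ⟩
  ■R1 : ∀ {G Γ Δ Σ Π A} →
        ⊢ ⟨ G ++ [ (Γ ⇒ A ∷ Δ , ↗) ] ∣ Σ ⇒ ■ A ∷ Π ⟩ →
        ⊢ ⟨ G ++ (Γ ⇒ Δ , ↗) ∷ (Σ ⇒ ■ A ∷ Π , ↙) ∷ [] ∣ ε ⇒ [ A ] ⟩ →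
        ⊢ ⟨ G ++ [ (Γ ⇒ Δ , ↗) ] ∣ Σ ⇒ ■ A ∷ Π ⟩
  □R2 : ∀ {G Γ Δ A} → EndsWith ↗ G →
        ⊢ ⟨ G ++ [ (Γ ⇒ □ A ∷ Δ , ↗) ] ∣ ε ⇒ [ A ] ⟩ →
        ⊢ ⟨ G ∣ Γ ⇒ □ A ∷ Δ ⟩
  ■R2 : ∀ {G Γ Δ A} → EndsWith ↙ G →
        ⊢ ⟨ G ++ [ (Γ ⇒ ■ A ∷ Δ , ↙) ] ∣ ε ⇒ [ A ] ⟩ →
        ⊢ ⟨ G ∣ Γ ⇒ ■ A ∷ Δ ⟩
  □L1 : ∀ {G Γ Δ Σ Π A} →
        ⊢ ⟨ G ++ [ (□ A ∷ Γ ⇒ Δ , ↗) ] ∣ A ∷ Σ ⇒ Π ⟩ →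
        ⊢ ⟨ G ++ [ (□ A ∷ Γ ⇒ Δ , ↗) ] ∣ Σ ⇒ Π ⟩
  ■L1 : ∀ {G Γ Δ Σ Π A} →
        ⊢ ⟨ G ++ [ (■ A ∷ Γ ⇒ Δ , ↙) ] ∣ A ∷ Σ ⇒ Π ⟩ →
        ⊢ ⟨ G ++ [ (■ A ∷ Γ ⇒ Δ , ↙) ] ∣ Σ ⇒ Π ⟩
  □L2 : ∀ {G Γ Δ Σ Π A} →
        ⊢ ⟨ G ∣ A ∷ Γ ⇒ Δ ⟩ →
        ⊢ ⟨ G ++ [ (Γ ⇒ Δ , ↙) ] ∣ □ A ∷ Σ ⇒ Π ⟩
  ■L2 : ∀ {G Γ Δ Σ Π A} →
        ⊢ ⟨ G ∣ A ∷ Γ ⇒ Δ ⟩ →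
        ⊢ ⟨ G ++ [ (Γ ⇒ Δ , ↗) ] ∣ ■ A ∷ Σ ⇒ Π ⟩
  idr : ∀ {G Γ Δ p} → ⊢ ⟨ G ∣ atom p ∷ Γ ⇒ atom p ∷ Δ ⟩
  ⊥L  : ∀ {G Γ Δ} → ⊢ ⟨ G ∣ ⊥' ∷ Γ ⇒ Δ ⟩
  EW  : ∀ {G c d c'} → ⊢ ⟨ G ∣ c ⟩ → ⊢ ⟨ G ++ [ (c , d) ] ∣ c' ⟩
  ⊃R  : ∀ {G Γ Δ A B} →
        ⊢ ⟨ G ∣ A ∷ Γ ⇒ (A ⊃ B) ∷ B ∷ Δ ⟩ →
        ⊢ ⟨ G ∣ Γ ⇒ (A ⊃ B) ∷ Δ ⟩
  ⊃L  : ∀ {G Γ Δ A B} →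
        ⊢ ⟨ G ∣ (A ⊃ B) ∷ B ∷ Γ ⇒ Δ ⟩ →
        ⊢ ⟨ G ∣ (A ⊃ B) ∷ Γ ⇒ A ∷ Δ ⟩ →
        ⊢ ⟨ G ∣ (A ⊃ B) ∷ Γ ⇒ Δ ⟩

Weakening : Set
Weakening = ∀ G Γ Δ Σ Π H →
  ⊢ plug G (Γ ⇒ Δ) H → ⊢ plug G (Γ ++ Σ ⇒ Δ ++ Π) H

ContractionL : Set
ContractionL = ∀ G Γ Δ A H →
  ⊢ plug G (Γ ++ A ∷ A ∷ [] ⇒ Δ) H → ⊢ plug G (Γ ++ [ A ] ⇒ Δ) H

ContractionR : Set
ContractionR = ∀ G Γ Δ A H →
  ⊢ plug G (Γ ⇒ Δ ++ A ∷ A ∷ []) H → ⊢ plug G (Γ ⇒ Δ ++ [ A ]) H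

module Submission where

-- Weakening and contraction are both instances of one admissible rule: a
-- derivable sequent stays derivable when each component is replaced by one
-- containing at least the same formulae, read as sets, with the nesting shape
-- and arrows unchanged.  By induction on the derivation: the principal formulae
-- of the last rule still occur in the enlarged conclusion, a permutation brings
-- them to the front, and the premisses are enlarged in the same way.  As no
-- rule requires two occurrences of a formula, multiplicities never matter.

open import Defs
open import Data.Product using (_×_; _,_; ∃-syntax)
open import Data.Sum using (inj₁; inj₂)
open import Data.List using (List; []; _∷_; _++_; [_])
open import Data.List.Membership.Propositional using (_∈_)
open import Data.List.Membership.Propositional.Properties using (∈-∃++)
open import Data.List.Relation.Unary.Any using (here; there)
open import Data.List.Relation.Binary.Subset.Propositional using (_⊆_)
open import Data.List.Relation.Binary.Subset.Propositional.Properties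
  using (⊆-refl; ⊆-trans; ⊆-reflexive-↭; ⊆-respʳ-↭; ⊆-respˡ-↭; ∷⁺ʳ; ++⁺; xs⊆xs++ys)
open import Data.List.Relation.Binary.Permutation.Propositional
  using (_↭_; ↭-refl; ↭-sym; swap)
open import Data.List.Relation.Binary.Permutation.Propositional.Properties using (shift)
import Data.List.Relation.Binary.Pointwise as Pointwise
open Pointwise using (Pointwise; []; _∷_)
open import Relation.Binary.PropositionalEquality using (_≡_; refl)

∈⇒↭-∷ : ∀ {A : Set} {x : A} {xs} → x ∈ xs → ∃[ ys ] (x ∷ ys ↭ xs)
∈⇒↭-∷ {x = x} x∈xs with ys , zs , refl ← ∈-∃++ x∈xs = ys ++ zs , ↭-sym (shift x ys zs)

extract-principal : ∀ {A : Set} {x : A} {xs ys} → x ∷ xs ⊆ ys →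
                    ∃[ zs ] (x ∷ zs ↭ ys × x ∷ xs ⊆ x ∷ zs)
extract-principal xs⊆ys with zs , p ← ∈⇒↭-∷ (xs⊆ys (here refl)) =
  zs , p , ⊆-respʳ-↭ (↭-sym p) xs⊆ys

∷⁺ʳ-under-head : ∀ {A : Set} {x : A} y {xs ys} → x ∷ xs ⊆ x ∷ ys → x ∷ y ∷ xs ⊆ x ∷ y ∷ ys
∷⁺ʳ-under-head {x = x} y xs⊆ys =
  ⊆-respˡ-↭ (swap y x ↭-refl) (⊆-respʳ-↭ (swap y x ↭-refl) (∷⁺ʳ y xs⊆ys))

infix 4 _⊆C_ _⊆E_ _⊆P_ _⊆S_

_⊆C_ : Comp → Comp → Set
(Γ ⇒ Δ) ⊆C (Γ' ⇒ Δ') = (Γ ⊆ Γ') × (Δ ⊆ Δ')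

_⊆E_ : Comp × Dir → Comp × Dir → Set
(c , d) ⊆E (c' , d') = (c ⊆C c') × (d ≡ d')

_⊆P_ : Prefix → Prefix → Set
_⊆P_ = Pointwise _⊆E_

_⊆S_ : LNS → LNS → Set
⟨ G ∣ c ⟩ ⊆S ⟨ G' ∣ c' ⟩ = (G ⊆P G') × (c ⊆C c')

⊆C-refl : ∀ {c} → c ⊆C c
⊆C-refl = ⊆-refl , ⊆-refl

⊆P-refl : ∀ {G} → G ⊆P G
⊆P-refl = Pointwise.refl (⊆C-refl , refl)

≈C-⊆C-trans : ∀ {c c₁ c₂} → c ≈C c₁ → c₁ ⊆C c₂ → c ⊆C c₂
≈C-⊆C-trans (Γ↭ , Δ↭) (Γ⊆ , Δ⊆) = ⊆-trans (⊆-reflexive-↭ Γ↭) Γ⊆ , ⊆-trans (⊆-reflexive-↭ Δ↭) Δ⊆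

≈E-⊆E-trans : ∀ {e e₁ e₂} → e ≈E e₁ → e₁ ⊆E e₂ → e ⊆E e₂
≈E-⊆E-trans (c≈ , refl) (c⊆ , refl) = ≈C-⊆C-trans c≈ c⊆ , refl

≈S-⊆S-trans : ∀ {S S₁ S₂} → S ≈S S₁ → S₁ ⊆S S₂ → S ⊆S S₂
≈S-⊆S-trans {⟨ _ ∣ _ ⟩} {⟨ _ ∣ _ ⟩} {⟨ _ ∣ _ ⟩} (G≈ , c≈) (G⊆ , c⊆) =
  Pointwise.transitive ≈E-⊆E-trans G≈ G⊆ , ≈C-⊆C-trans c≈ c⊆

data ⊆P-∷ʳ-View (G : Prefix) (c : Comp) (d : Dir) : Prefix → Set where
  enlarged : ∀ {G' Γ' Δ'} → G ⊆P G' → c ⊆C (Γ' ⇒ Δ') →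
             ⊆P-∷ʳ-View G c d (G' ++ [ (Γ' ⇒ Δ' , d) ])

⊆P-∷ʳ⁻ : ∀ {G c d G₂} → G ++ [ (c , d) ] ⊆P G₂ → ⊆P-∷ʳ-View G c d G₂
⊆P-∷ʳ⁻ {[]} {G₂ = (_ ⇒ _ , _) ∷ []} ((c⊆ , refl) ∷ []) = enlarged [] c⊆
⊆P-∷ʳ⁻ {_ ∷ G} (e⊆ ∷ G⊆) with enlarged G⊆' c⊆ ← ⊆P-∷ʳ⁻ {G} G⊆ = enlarged (e⊆ ∷ G⊆') c⊆

EndsWith-⊆P : ∀ {d G G₂} → EndsWith d G → G ⊆P G₂ → EndsWith d G₂
EndsWith-⊆P (inj₁ refl) [] = inj₁ refl
EndsWith-⊆P (inj₂ (G' , c , refl)) G⊆ with enlarged {G''} {Γ'} {Δ'} _ _ ← ⊆P-∷ʳ⁻ {G'} G⊆ =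
  inj₂ (G'' , (Γ' ⇒ Δ') , refl)

≈P-refl : ∀ {G} → Pointwise _≈E_ G G
≈P-refl = Pointwise.refl ((↭-refl , ↭-refl) , refl)

ante-↭ : ∀ {G Γ Γ' Δ} → ⊢ ⟨ G ∣ Γ ⇒ Δ ⟩ → Γ ↭ Γ' → ⊢ ⟨ G ∣ Γ' ⇒ Δ ⟩
ante-↭ D p = perm D (≈P-refl , p , ↭-refl)

succ-↭ : ∀ {G Γ Δ Δ'} → ⊢ ⟨ G ∣ Γ ⇒ Δ ⟩ → Δ ↭ Δ' → ⊢ ⟨ G ∣ Γ ⇒ Δ' ⟩
succ-↭ D p = perm D (≈P-refl , ↭-refl , p)

pre-ante-↭ : ∀ {G Γ Γ' Δ d c} → ⊢ ⟨ G ++ [ (Γ ⇒ Δ , d) ] ∣ c ⟩ → Γ ↭ Γ' →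
             ⊢ ⟨ G ++ [ (Γ' ⇒ Δ , d) ] ∣ c ⟩
pre-ante-↭ D p =
  perm D (Pointwise.++⁺ ≈P-refl (((p , ↭-refl) , refl) ∷ []) , ↭-refl , ↭-refl)

⊆P-∷ʳ⁺ : ∀ {G G' c c' d} → G ⊆P G' → c ⊆C c' → G ++ [ (c , d) ] ⊆P G' ++ [ (c' , d) ]
⊆P-∷ʳ⁺ G⊆ c⊆ = Pointwise.++⁺ G⊆ ((c⊆ , refl) ∷ [])

⊢-⊆S : ∀ {S} → ⊢ S → ∀ {S'} → S ⊆S S' → ⊢ S'
⊢-⊆S (perm D S≈) S⊆ = ⊢-⊆S D (≈S-⊆S-trans S≈ S⊆)
⊢-⊆S (□R1 D₁ D₂) {⟨ _ ∣ _ ⇒ _ ⟩} (G⊆ , Σ⊆ , Π⊆)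
  with enlarged G⊆' (Γ⊆ , Δ⊆) ← ⊆P-∷ʳ⁻ G⊆ | _ , p , Π⊆' ← extract-principal Π⊆ =
  succ-↭ (□R1 (⊢-⊆S D₁ (⊆P-∷ʳ⁺ G⊆' (Γ⊆ , ∷⁺ʳ _ Δ⊆) , Σ⊆ , Π⊆'))
              (⊢-⊆S D₂ (Pointwise.++⁺ G⊆' (((Γ⊆ , Δ⊆) , refl) ∷ ((Σ⊆ , Π⊆') , refl) ∷ []) , ⊆C-refl)))
         p
⊢-⊆S (■R1 D₁ D₂) {⟨ _ ∣ _ ⇒ _ ⟩} (G⊆ , Σ⊆ , Π⊆)
  with enlarged G⊆' (Γ⊆ , Δ⊆) ← ⊆P-∷ʳ⁻ G⊆ | _ , p , Π⊆' ← extract-principal Π⊆ =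
  succ-↭ (■R1 (⊢-⊆S D₁ (⊆P-∷ʳ⁺ G⊆' (Γ⊆ , ∷⁺ʳ _ Δ⊆) , Σ⊆ , Π⊆'))
              (⊢-⊆S D₂ (Pointwise.++⁺ G⊆' (((Γ⊆ , Δ⊆) , refl) ∷ ((Σ⊆ , Π⊆') , refl) ∷ []) , ⊆C-refl)))
         p
⊢-⊆S (□R2 ends D) {⟨ _ ∣ _ ⇒ _ ⟩} (G⊆ , Γ⊆ , Δ⊆) with _ , p , Δ⊆' ← extract-principal Δ⊆ =
  succ-↭ (□R2 (EndsWith-⊆P ends G⊆) (⊢-⊆S D (⊆P-∷ʳ⁺ G⊆ (Γ⊆ , Δ⊆') , ⊆C-refl))) p
⊢-⊆S (■R2 ends D) {⟨ _ ∣ _ ⇒ _ ⟩} (G⊆ , Γ⊆ , Δ⊆) with _ , p , Δ⊆' ← extract-principal Δ⊆ =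
  succ-↭ (■R2 (EndsWith-⊆P ends G⊆) (⊢-⊆S D (⊆P-∷ʳ⁺ G⊆ (Γ⊆ , Δ⊆') , ⊆C-refl))) p
⊢-⊆S (□L1 D) {⟨ _ ∣ _ ⇒ _ ⟩} (G⊆ , Σ⊆ , Π⊆)
  with enlarged G⊆' (Γ⊆ , Δ⊆) ← ⊆P-∷ʳ⁻ G⊆
  with _ , p , Γ⊆' ← extract-principal Γ⊆ =
  pre-ante-↭ (□L1 (⊢-⊆S D (⊆P-∷ʳ⁺ G⊆' (Γ⊆' , Δ⊆) , ∷⁺ʳ _ Σ⊆ , Π⊆))) p
⊢-⊆S (■L1 D) {⟨ _ ∣ _ ⇒ _ ⟩} (G⊆ , Σ⊆ , Π⊆)
  with enlarged G⊆' (Γ⊆ , Δ⊆) ← ⊆P-∷ʳ⁻ G⊆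
  with _ , p , Γ⊆' ← extract-principal Γ⊆ =
  pre-ante-↭ (■L1 (⊢-⊆S D (⊆P-∷ʳ⁺ G⊆' (Γ⊆' , Δ⊆) , ∷⁺ʳ _ Σ⊆ , Π⊆))) p
⊢-⊆S (□L2 D) {⟨ _ ∣ _ ⇒ _ ⟩} (G⊆ , Σ⊆ , Π⊆)
  with enlarged G⊆' (Γ⊆ , Δ⊆) ← ⊆P-∷ʳ⁻ G⊆ | _ , p , _ ← extract-principal Σ⊆ =
  ante-↭ (□L2 (⊢-⊆S D (G⊆' , ∷⁺ʳ _ Γ⊆ , Δ⊆))) p
⊢-⊆S (■L2 D) {⟨ _ ∣ _ ⇒ _ ⟩} (G⊆ , Σ⊆ , Π⊆)
  with enlarged G⊆' (Γ⊆ , Δ⊆) ← ⊆P-∷ʳ⁻ G⊆ | _ , p , _ ← extract-principal Σ⊆ =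
  ante-↭ (■L2 (⊢-⊆S D (G⊆' , ∷⁺ʳ _ Γ⊆ , Δ⊆))) p
⊢-⊆S idr {⟨ G₂ ∣ _ ⇒ _ ⟩} (_ , Γ⊆ , Δ⊆)
  with _ , p , _ ← extract-principal Γ⊆ | _ , q , _ ← extract-principal Δ⊆ =
  succ-↭ (ante-↭ (idr {G = G₂}) p) q
⊢-⊆S ⊥L {⟨ G₂ ∣ _ ⇒ _ ⟩} (_ , Γ⊆ , _) with _ , p , _ ← extract-principal Γ⊆ =
  ante-↭ (⊥L {G = G₂}) p
⊢-⊆S (EW D) {⟨ _ ∣ _ ⟩} (G⊆ , _) with enlarged G⊆' c⊆ ← ⊆P-∷ʳ⁻ G⊆ =
  EW (⊢-⊆S D (G⊆' , c⊆))
⊢-⊆S (⊃R {B = B} D) {⟨ _ ∣ _ ⇒ _ ⟩} (G⊆ , Γ⊆ , Δ⊆) with _ , p , Δ⊆' ← extract-principal Δ⊆ =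
  succ-↭ (⊃R (⊢-⊆S D (G⊆ , ∷⁺ʳ _ Γ⊆ , ∷⁺ʳ-under-head B Δ⊆'))) p
⊢-⊆S (⊃L {B = B} D₁ D₂) {⟨ _ ∣ _ ⇒ _ ⟩} (G⊆ , Γ⊆ , Δ⊆) with _ , p , Γ⊆' ← extract-principal Γ⊆ =
  ante-↭ (⊃L (⊢-⊆S D₁ (G⊆ , ∷⁺ʳ-under-head B Γ⊆' , Δ⊆))
             (⊢-⊆S D₂ (G⊆ , Γ⊆' , ∷⁺ʳ _ Δ⊆)))
         p

plug-⊆S : ∀ H {G G' c c'} → G ⊆P G' → c ⊆C c' → plug G c H ⊆S plug G' c' H
plug-⊆S []      G⊆ c⊆ = G⊆ , c⊆
plug-⊆S (_ ∷ H) G⊆ c⊆ = plug-⊆S H (⊆P-∷ʳ⁺ G⊆ c⊆) ⊆C-refl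

⊢-plug-⊆C : ∀ G H {c c'} → c ⊆C c' → ⊢ plug G c H → ⊢ plug G c' H
⊢-plug-⊆C G H c⊆ D = ⊢-⊆S D (plug-⊆S H ⊆P-refl c⊆)

++-contract-⊆ : ∀ {A : Set} xs (x : A) → xs ++ x ∷ x ∷ [] ⊆ xs ++ [ x ]
++-contract-⊆ xs x = ++⁺ (⊆-refl {x = xs}) λ
  { (here x≡)        → here x≡
  ; (there (here x≡)) → here x≡
  ; (there (there ())) }

lemma13 : Weakening × ContractionL × ContractionR
lemma13 = (λ G Γ Δ Σ Π H → ⊢-plug-⊆C G H (xs⊆xs++ys Γ Σ , xs⊆xs++ys Δ Π))
        , (λ G Γ Δ A H → ⊢-plug-⊆C G H (++-contract-⊆ Γ A , ⊆-refl))
        , (λ G Γ Δ A H → ⊢-plug-⊆C G H (⊆-refl , ++-contract-⊆ Δ A))
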